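{- Let $k$ and $c$ be positive integers with $2c<k$, let $S=[k]\setminus\{k-c\}$, and let $(a_n)_{n\ge1}$ be the $S$-LID sequence. For $n\ge0$ let $d_n$ be the number of sets $L\subseteq\{1,\dots,n\}$ (including the empty set) such that $|i-j|\notin S$ for all $i,j\in L$ (i.e. the number of $S$-LID decompositions formed with $\{a_1,\dots,a_n\}$). Then for all integers $n>k+1$, \[ d_n = d_{n-1}+d_{n-k+c}-d_{n-k+c-1}+d_{n-k-1}. \]
   Context: $[k]=\{1,\dots,k\}$. For a set $S$ of positive integers, the $S$-legal index difference ($S$-LID) sequence $(a_n)_{n\ge 1}$ is defined recursively: for each positive integer $n$, $a_n$ is the smallest positive integer that cannot be written as $\sum_{\ell\in L} a_\ell$ for some set $L \subseteq \{1,\dots,n-1\}$ such that $|i-j|\notin S$ for all $i,j\in L$ (the empty sum is $0$). An $S$-LID decomposition of a nonnegative integer $m$ using $\{a_1,\dots,a_n\}$ is a set $L\subseteq\{1,\dots,n\}$ with $|i-j|\notin S$ for all $i,j\in L$ and $m=\sum_{\ell\in L}a_\ell$. -}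

module Defs where

open import Data.Nat using (ℕ; zero; suc; _+_; _∸_; _≤_; _<_; _≤?_; _≟_)
open import Relation.Binary.PropositionalEquality using (_≡_)
open import Data.Nat.Properties using ()
open import Data.Fin using (Fin; toℕ)
open import Data.Fin.Subset using (Subset; _∈_)
open import Data.Fin.Subset.Properties using (_∈?_)
open import Data.Fin.Properties using (all?)
open import Data.Bool using (Bool; true; false)
open import Data.Vec using (Vec; []; _∷_)
open import Data.List using (List; []; _∷_; map; _++_; filter; length)
open import Data.Product using (_×_; _,_)
open import Data.Empty using (⊥)
open import Relation.Nullary using (¬_; Dec; yes; no)
open import Relation.Nullary.Decidable using (¬?; _×-dec_; _→-dec_)
open import Relation.Unary using (Decidable)

∣_-_∣ : ℕ → ℕ → ℕ
∣ i - j ∣ = (i ∸ j) + (j ∸ i)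

InS : ℕ → ℕ → ℕ → Set
InS k c d = (1 ≤ d) × (d ≤ k) × ¬ (d ≡ k ∸ c)

inS? : (k c d : ℕ) → Dec (InS k c d)
inS? k c d = (1 ≤? d) ×-dec ((d ≤? k) ×-dec ¬? (d ≟ k ∸ c))

-- A subset L ⊆ Fin n represents the set { toℕ i + 1 | i ∈ L } ⊆ {1,…,n}.
-- (The shift by 1 does not affect differences.)
-- L is S-legal iff |i - j| ∉ S for all i, j ∈ L.
Legal : (k c : ℕ) {n : ℕ} → Subset n → Set
Legal k c {n} L = (i j : Fin n) → i ∈ L → j ∈ L → ¬ InS k c ∣ toℕ i - toℕ j ∣

legal? : (k c : ℕ) {n : ℕ} → Decidable (Legal k c {n})
legal? k c {n} L =
  all? λ i → all? λ j → (i ∈? L) →-dec ((j ∈? L) →-dec ¬? (inS? k c ∣ toℕ i - toℕ j ∣))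

allSubsets : (n : ℕ) → List (Subset n)
allSubsets zero = [] ∷ []
allSubsets (suc n) = map (true ∷_) (allSubsets n) ++ map (false ∷_) (allSubsets n)

d : (k c n : ℕ) → ℕ
d k c n = length (filter (legal? k c) (allSubsets n))

{-# OPTIONS --safe #-}
module Submission where

-- Splitting the legal sets of {1,…,n+1} on whether they contain 1 gives d (n+1) = d n + dFar 1 n,
-- where dFar o n counts the legal subsets of {1,…,n} that stay legal next to an extra point at
-- distance o before position 1. Peeling off position 1 once more, such a point excludes it exactly
-- when o ∈ S, so dFar o (n+1) = dFar (o+1) n for o ∈ S, and for o > k the point imposes nothing.
-- All of 1,…,k except k − c lie in S; at distance k − c position 1 may be taken, and then a set
-- compatible with distance 1 is automatically compatible with distance k − c + 1, because c < k − c.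
-- Hence dFar 1 (n+k) = dFar 1 (n+c) + d n, and eliminating dFar 1 gives the recurrence.

open import Defs
open import Data.Nat using (ℕ; zero; suc; _+_; _∸_; _*_; _≤_; _<_; z≤n; s≤s)
open import Data.Nat.Properties
open import Data.Integer using (+_) renaming (_+_ to _+ℤ_; _-_ to _-ℤ_)
import Data.Integer.Properties as ℤ
open import Data.Integer.Solver using (module +-*-Solver)
open import Data.Fin using (Fin; toℕ) renaming (zero to fzero; suc to fsuc)
open import Data.Fin.Subset using (Subset; _∈_)
open import Data.Fin.Subset.Properties using (_∈?_)
open import Data.Fin.Properties using (all?)
open import Data.Vec.Base using (_∷_; here; there)
open import Data.Bool using (true; false)
open import Data.List using (List; []; _∷_; _++_; map; filter; length)
open import Data.List.Properties using (length-++; length-map; filter-++; filter-≐; filter-none)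
import Data.List.Relation.Unary.All as All
open import Data.Product using (∃; _×_; _,_; proj₁; proj₂)
open import Function using (_∘_; flip)
open import Level using (0ℓ)
open import Relation.Nullary using (¬_; yes; no)
open import Relation.Nullary.Decidable using (¬?; _×-dec_; _→-dec_)
open import Relation.Unary using (Pred; Decidable)
open import Relation.Binary.PropositionalEquality
  using (_≡_; _≢_; refl; sym; trans; cong; cong₂; subst; module ≡-Reasoning)

filter-map : ∀ {A B : Set} {P : Pred B 0ℓ} (P? : Decidable P) (f : A → B) (xs : List A) →
  filter P? (map f xs) ≡ map f (filter (P? ∘ f) xs)
filter-map P? f [] = refl
filter-map P? f (x ∷ xs) with P? (f x)
... | yes _ = cong (f x ∷_) (filter-map P? f xs)
... | no _ = filter-map P? f xs

module _ {n : ℕ} where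

  count : {P : Pred (Subset n) 0ℓ} → Decidable P → ℕ
  count P? = length (filter P? (allSubsets n))

  count-cong : {P Q : Pred (Subset n) 0ℓ} (P? : Decidable P) (Q? : Decidable Q) →
    (∀ L → P L → Q L) → (∀ L → Q L → P L) → count P? ≡ count Q?
  count-cong P? Q? P⇒Q Q⇒P =
    cong length (filter-≐ P? Q? ((λ {L} → P⇒Q L) , (λ {L} → Q⇒P L)) (allSubsets n))

  count-none : {P : Pred (Subset n) 0ℓ} (P? : Decidable P) → (∀ L → ¬ P L) → count P? ≡ 0
  count-none P? ¬P = cong length (filter-none P? (All.universal ¬P (allSubsets n)))

count-suc : ∀ {n} {P : Pred (Subset (suc n)) 0ℓ} (P? : Decidable P) →
  count P? ≡ count (P? ∘ (true ∷_)) + count (P? ∘ (false ∷_))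
count-suc {n} P? = begin
  length (filter P? (map (true ∷_) Ls ++ map (false ∷_) Ls))
    ≡⟨ cong length (filter-++ P? (map (true ∷_) Ls) _) ⟩
  length (filter P? (map (true ∷_) Ls) ++ filter P? (map (false ∷_) Ls))
    ≡⟨ length-++ (filter P? (map (true ∷_) Ls)) ⟩
  length (filter P? (map (true ∷_) Ls)) + length (filter P? (map (false ∷_) Ls))
    ≡⟨ cong₂ _+_ (length-filter-map (true ∷_)) (length-filter-map (false ∷_)) ⟩
  count (P? ∘ (true ∷_)) + count (P? ∘ (false ∷_)) ∎
  where
  open ≡-Reasoning
  Ls = allSubsets n
  length-filter-map : ∀ f → length (filter P? (map f Ls)) ≡ length (filter (P? ∘ f) Ls)
  length-filter-map f = trans (cong length (filter-map P? f Ls)) (length-map f (filter (P? ∘ f) Ls))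

pos-+-insert-difference : ∀ a x b e → + (a + (b + e)) ≡ (+ a +ℤ + (x + b)) -ℤ + x +ℤ + e
pos-+-insert-difference a x b e = begin
  + (a + (b + e))
    ≡⟨ trans (ℤ.pos-+ a (b + e)) (cong (+ a +ℤ_) (ℤ.pos-+ b e)) ⟩
  + a +ℤ (+ b +ℤ + e)
    ≡⟨ solve 4 (λ A X B E → A :+ (B :+ E) := (A :+ (X :+ B)) :- X :+ E) refl (+ a) (+ x) (+ b) (+ e) ⟩
  (+ a +ℤ (+ x +ℤ + b)) -ℤ + x +ℤ + e
    ≡⟨ cong (λ y → (+ a +ℤ y) -ℤ + x +ℤ + e) (sym (ℤ.pos-+ x b)) ⟩
  (+ a +ℤ + (x + b)) -ℤ + x +ℤ + e  ∎
  where
  open ≡-Reasoning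
  open +-*-Solver

module _ (k c : ℕ) where

  Far : ℕ → ∀ {n} → Subset n → Set
  Far o {n} L = (j : Fin n) → j ∈ L → ¬ InS k c (o + toℕ j)

  far? : ∀ o {n} → Decidable (Far o {n})
  far? o L = all? λ j → (j ∈? L) →-dec ¬? (inS? k c (o + toℕ j))

  LegalFar : ℕ → ∀ {n} → Subset n → Set
  LegalFar o L = Legal k c L × Far o L

  legalFar? : ∀ o {n} → Decidable (LegalFar o {n})
  legalFar? o L = legal? k c L ×-dec far? o L

  dFar : ℕ → ℕ → ℕ
  dFar o n = count (legalFar? o {n})

  module _ {n : ℕ} (L : Subset n) where

    Legal-∷⁻ : ∀ b → Legal k c (b ∷ L) → Legal k c L
    Legal-∷⁻ b lg i j i∈ j∈ = lg (fsuc i) (fsuc j) (there i∈) (there j∈)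

    Legal-false⁺ : Legal k c L → Legal k c (false ∷ L)
    Legal-false⁺ lg (fsuc i) (fsuc j) (there i∈) (there j∈) = lg i j i∈ j∈

    Legal-true⁻ : Legal k c (true ∷ L) → LegalFar 1 L
    Legal-true⁻ lg = Legal-∷⁻ true lg , λ j j∈ → lg fzero (fsuc j) here (there j∈)

    Legal-true⁺ : LegalFar 1 L → Legal k c (true ∷ L)
    Legal-true⁺ _ fzero fzero _ _ (() , _)
    Legal-true⁺ (_ , far) fzero (fsuc j) _ (there j∈) = far j j∈
    Legal-true⁺ (_ , far) (fsuc i) fzero (there i∈) _ =
      far i i∈ ∘ subst (InS k c) (+-identityʳ (suc (toℕ i)))
    Legal-true⁺ (lg , _) (fsuc i) (fsuc j) (there i∈) (there j∈) = lg i j i∈ j∈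

    Far-∷⁻ : ∀ b o → Far o (b ∷ L) → Far (suc o) L
    Far-∷⁻ b o far j j∈ = far (fsuc j) (there j∈) ∘ subst (InS k c) (sym (+-suc o (toℕ j)))

    Far-false⁺ : ∀ o → Far (suc o) L → Far o (false ∷ L)
    Far-false⁺ o far (fsuc j) (there j∈) = far j j∈ ∘ subst (InS k c) (+-suc o (toℕ j))

    Far-true⁻ : ∀ o → Far o (true ∷ L) → ¬ InS k c o × Far (suc o) L
    Far-true⁻ o far = far fzero here ∘ subst (InS k c) (sym (+-identityʳ o))
                    , Far-∷⁻ true o far

    Far-true⁺ : ∀ o → ¬ InS k c o → Far (suc o) L → Far o (true ∷ L)
    Far-true⁺ o ¬o∈S far fzero here = ¬o∈S ∘ subst (InS k c) (+-identityʳ o)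
    Far-true⁺ o ¬o∈S far (fsuc j) (there j∈) = Far-false⁺ o far (fsuc j) (there j∈)

    Far-beyond : ∀ o → k < o → Far o L
    Far-beyond o k<o j j∈ (_ , o+j≤k , _) = <⇒≱ k<o (≤-trans (m≤m+n o (toℕ j)) o+j≤k)

  dFar-suc : ∀ o n → dFar o (suc n) ≡ count (legalFar? o {suc n} ∘ (true ∷_)) + dFar (suc o) n
  dFar-suc o n = trans (count-suc {n} (legalFar? o))
    (cong (λ m → count (legalFar? o {suc n} ∘ (true ∷_)) + m) (count-cong {n} _ _
    (λ L (lg , far) → Legal-∷⁻ L false lg , Far-∷⁻ L false o far)
    (λ L (lg , far) → Legal-false⁺ L lg , Far-false⁺ L o far)))

  d-suc : ∀ n → d k c (suc n) ≡ d k c n + dFar 1 n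
  d-suc n = trans (count-suc {n} (legal? k c))
    (trans (+-comm (count (legal? k c {suc n} ∘ (true ∷_))) _) (cong₂ _+_
    (count-cong {n} _ _ (λ L → Legal-∷⁻ L false) Legal-false⁺)
    (count-cong {n} _ _ Legal-true⁻ Legal-true⁺)))

  dFar-suc-forced : ∀ {o} n → InS k c o → dFar o (suc n) ≡ dFar (suc o) n
  dFar-suc-forced {o} n o∈S = trans (dFar-suc o n)
    (cong (_+ dFar (suc o) n) (count-none {n} _ (λ L (_ , far) → proj₁ (Far-true⁻ L o far) o∈S)))

  dFar-+-forced : ∀ o m n → (∀ i → i < m → InS k c (o + i)) → dFar o (m + n) ≡ dFar (o + m) n
  dFar-+-forced o zero n _ = cong (λ o′ → dFar o′ n) (sym (+-identityʳ o))
  dFar-+-forced o (suc m) n forced = begin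
    dFar o (suc (m + n))
      ≡⟨ dFar-suc-forced (m + n) (subst (InS k c) (+-identityʳ o) (forced 0 (s≤s z≤n))) ⟩
    dFar (suc o) (m + n)
      ≡⟨ dFar-+-forced (suc o) m n (λ i i<m → subst (InS k c) (+-suc o i) (forced (suc i) (s≤s i<m))) ⟩
    dFar (suc o + m) n
      ≡⟨ cong (λ o′ → dFar o′ n) (sym (+-suc o m)) ⟩
    dFar (o + suc m) n    ∎
    where open ≡-Reasoning

  dFar-beyond : ∀ o n → k < o → dFar o n ≡ d k c n
  dFar-beyond o n k<o = count-cong {n} _ _ (λ L → proj₁) (λ L lg → lg , Far-beyond L o k<o)

  module Gap (g : ℕ) (c≤g : c ≤ g) (k≡1+g+c : k ≡ suc g + c) where

    k∸c≡1+g : k ∸ c ≡ suc g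
    k∸c≡1+g = trans (cong (_∸ c) k≡1+g+c) (m+n∸n≡m (suc g) c)

    ¬InS-gap : ¬ InS k c (suc g)
    ¬InS-gap (_ , _ , 1+g≢k∸c) = 1+g≢k∸c (sym k∸c≡1+g)

    InS-unless-gap : ∀ {x} → 1 ≤ x → x ≤ k → x ≢ suc g → InS k c x
    InS-unless-gap 1≤x x≤k x≢1+g = 1≤x , x≤k , x≢1+g ∘ flip trans k∸c≡1+g

    InS-before-gap : ∀ i → i < g → InS k c (1 + i)
    InS-before-gap i i<g = InS-unless-gap (s≤s z≤n) (≤-trans i<g g≤k) (<⇒≢ (s≤s i<g))
      where
      g≤k : g ≤ k
      g≤k = ≤-trans (n≤1+n g) (≤-trans (m≤m+n (suc g) c) (≤-reflexive (sym k≡1+g+c)))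

    InS-after-gap : ∀ i → i < c → InS k c (suc (suc g) + i)
    InS-after-gap i i<c = InS-unless-gap (s≤s z≤n)
      (≤-trans (≤-reflexive (sym (+-suc (suc g) i)))
        (≤-trans (+-monoʳ-≤ (suc g) i<c) (≤-reflexive (sym k≡1+g+c))))
      (>⇒≢ (m≤m+n (suc (suc g)) i))

    Far-1⇒Far-past-gap : ∀ {n} (L : Subset n) → Far 1 L → Far (suc (suc g)) L
    Far-1⇒Far-past-gap L far j j∈ (_ , 2+g+j≤k , _) =
      far j j∈ (InS-before-gap (toℕ j) (≤-trans 1+j≤c c≤g))
      where
      1+j≤c : suc (toℕ j) ≤ c
      1+j≤c = +-cancelˡ-≤ (suc g) _ _
        (≤-trans (≤-reflexive (+-suc (suc g) (toℕ j))) (≤-trans 2+g+j≤k (≤-reflexive k≡1+g+c)))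

    dFar-suc-gap : ∀ n → dFar (suc g) (suc n) ≡ dFar 1 n + dFar (suc (suc g)) n
    dFar-suc-gap n = trans (dFar-suc (suc g) n) (cong (_+ dFar (suc (suc g)) n) (count-cong {n} _ _
      (λ L (lg , _) → Legal-true⁻ L lg)
      (λ L lgFar → Legal-true⁺ L lgFar
                 , Far-true⁺ L (suc g) ¬InS-gap (Far-1⇒Far-past-gap L (proj₂ lgFar)))))

    dFar-1-+k : ∀ M → dFar 1 (k + M) ≡ dFar 1 (c + M) + d k c M
    dFar-1-+k M = begin
      dFar 1 (k + M)
        ≡⟨ cong (dFar 1) k+M≡g+[1+c+M] ⟩
      dFar 1 (g + suc (c + M))
        ≡⟨ dFar-+-forced 1 g (suc (c + M)) InS-before-gap ⟩
      dFar (suc g) (suc (c + M))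
        ≡⟨ dFar-suc-gap (c + M) ⟩
      dFar 1 (c + M) + dFar (suc (suc g)) (c + M)
        ≡⟨ cong (λ m → dFar 1 (c + M) + m) (dFar-+-forced (suc (suc g)) c M InS-after-gap) ⟩
      dFar 1 (c + M) + dFar (suc (suc g) + c) M
        ≡⟨ cong (λ m → dFar 1 (c + M) + m) (dFar-beyond _ M (s≤s (≤-reflexive k≡1+g+c))) ⟩
      dFar 1 (c + M) + d k c M  ∎
      where
      open ≡-Reasoning
      k+M≡g+[1+c+M] : k + M ≡ g + suc (c + M)
      k+M≡g+[1+c+M] = trans (cong (_+ M) k≡1+g+c) (trans (+-assoc (suc g) c M) (sym (+-suc g (c + M))))

    d-recurrence : ∀ M → + d k c (suc (k + M)) ≡
      (+ d k c (k + M) +ℤ + d k c (suc M + c)) -ℤ + d k c (M + c) +ℤ + d k c M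
    d-recurrence M rewrite +-comm M c | d-suc (k + M) | dFar-1-+k M | d-suc (c + M) =
      pos-+-insert-difference (d k c (k + M)) (d k c (c + M)) (dFar 1 (c + M)) (d k c M)

gap-split : ∀ {k c} → 2 * c < k → ∃ λ g → c ≤ g × k ≡ suc g + c
gap-split {k} {c} 2c<k = k ∸ suc c , c≤k∸[1+c] , sym 1+[k∸[1+c]]+c≡k
  where
  c+[1+c]≤k : c + suc c ≤ k
  c+[1+c]≤k = subst (_≤ k) (trans (cong (λ x → suc (c + x)) (+-identityʳ c)) (sym (+-suc c c))) 2c<k
  c≤k∸[1+c] : c ≤ k ∸ suc c
  c≤k∸[1+c] = m+n≤o⇒m≤o∸n c c+[1+c]≤k
  1+[k∸[1+c]]+c≡k : suc (k ∸ suc c) + c ≡ k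
  1+[k∸[1+c]]+c≡k =
    trans (sym (+-suc (k ∸ suc c) c)) (m∸n+n≡m (≤-trans (m≤n+m (suc c) c) c+[1+c]≤k))

lemma4p6 : (k c : ℕ) → 0 < c → 2 * c < k → (n : ℕ) → k + 1 < n →
    + d k c n ≡ (+ d k c (n ∸ 1) +ℤ + d k c (n ∸ k + c)) -ℤ + d k c (n ∸ k + c ∸ 1) +ℤ + d k c (n ∸ k ∸ 1)
lemma4p6 k c _ 2c<k n k+1<n
  with g , c≤g , k≡1+g+c ← gap-split {k} {c} 2c<k
     | M , refl ← m≤n⇒∃[o]m+o≡n (<⇒≤ (subst (_< n) (+-comm k 1) k+1<n))
  rewrite trans (cong (_∸ k) (sym (+-suc k M))) (m+n∸m≡n k (suc M))
  = Gap.d-recurrence k c g c≤g k≡1+g+c M
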